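{- Let $X$ be an infinite subset of $\mathbb{N}$. Then there are infinite sets $A,B\subseteq X$ with $A\cap B=\emptyset$ that are strongly mutually unembeddable, i.e., for every $C\subseteq A$ with $|C|=2$ we have $C\not\leq_{fe}B$, and for every $D\subseteq B$ with $|D|=2$ we have $D\not\leq_{fe}A$.
   Context: $\mathbb{N}=\{0,1,2,\dots\}$. For $A,B\subseteq\mathbb{N}$, $A\leq_{fe}B$ means that for every finite $F\subseteq A$ there is $k\in\mathbb{N}$ with $F+k\subseteq B$. -}

module Defs where

open import Level using (0ℓ)
open import Data.Nat using (ℕ; _+_; _≤_)
open import Data.Product using (Σ; _×_; ∃-syntax)
open import Data.Sum using (_⊎_)
open import Data.Empty using (⊥)
open import Data.List using (List)
open import Data.List.Relation.Unary.All using (All)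
open import Relation.Nullary using (¬_)
open import Relation.Binary.PropositionalEquality using (_≡_)

SubsetN : Set₁
SubsetN = ℕ → Set

_⊆_ : SubsetN → SubsetN → Set
A ⊆ B = ∀ x → A x → B x

-- An infinite subset of ℕ: unbounded (classically equivalent to "not finite").
Infinite : SubsetN → Set
Infinite X = ∀ n → ∃[ m ] (n ≤ m × X m)

Disjoint : SubsetN → SubsetN → Set
Disjoint A B = ∀ x → A x → B x → ⊥

HasSize2 : SubsetN → Set
HasSize2 C = ∃[ a ] ∃[ b ] (¬ (a ≡ b) × (∀ x → (C x → (x ≡ a ⊎ x ≡ b)) × ((x ≡ a ⊎ x ≡ b) → C x)))

_≤fe_ : SubsetN → SubsetN → Set
A ≤fe B = (F : List ℕ) → All A F → ∃[ k ] All (λ x → B (x + k)) F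

-- Pick x₀ < x₁ < ⋯ in X with x (n+1) > 2 x n. Then in a gap x j − x i with
-- i < j the term x j exceeds every x m + x m' with m, m' < j, so equal gaps
-- have equal upper indices; consequently two distinct terms of the sequence
-- can be translated into the sequence only by 0. The even- and odd-indexed
-- terms therefore form disjoint infinite sets, neither of which has a
-- two-element subset embedding into the other.
module Submission where

open import Defs
open import Data.Product using (Σ; _×_; _,_; proj₁; proj₂; ∃-syntax)
open import Data.Sum using (inj₁; inj₂)
open import Data.Nat using (ℕ; zero; suc; _+_; _*_; _≤_; _<_; z≤n; s≤s)
open import Data.Nat.Properties
open import Data.List using ([]; _∷_)
open import Data.List.Relation.Unary.All using ([]; _∷_)
open import Data.Empty using (⊥-elim)
open import Function using (_∘_)
open import Relation.Nullary using (¬_)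
open import Relation.Binary.PropositionalEquality
open import Relation.Binary.Definitions using (tri<; tri≈; tri>)

Lacunary : (ℕ → ℕ) → Set
Lacunary s = ∀ n → s n + s n < s (suc n)

image : (ℕ → ℕ) → SubsetN → SubsetN
image s I x = ∃[ i ] (I i × s i ≡ x)

Even Odd : SubsetN
Even n = ∃[ p ] n ≡ 2 * p
Odd n = ∃[ p ] n ≡ suc (2 * p)

even-odd-disjoint : Disjoint Even Odd
even-odd-disjoint _ (p , refl) (q , e) = even≢odd p q e

even-infinite : Infinite Even
even-infinite n = 2 * n , m≤n*m n 2 , n , refl

odd-infinite : Infinite Odd
odd-infinite n = suc (2 * n) , m≤n⇒m≤1+n (m≤n*m n 2) , n , refl

lacunary-sequence-in : (X : SubsetN) → Infinite X →
  Σ (ℕ → ℕ) λ s → Lacunary s × (∀ n → X (s n))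
lacunary-sequence-in X inf = s , lacunary , s∈X
  where
  s : ℕ → ℕ
  s zero = proj₁ (inf 0)
  s (suc n) = proj₁ (inf (suc (s n + s n)))

  lacunary : Lacunary s
  lacunary n = proj₁ (proj₂ (inf (suc (s n + s n))))

  s∈X : ∀ n → X (s n)
  s∈X zero = proj₂ (proj₂ (inf 0))
  s∈X (suc n) = proj₂ (proj₂ (inf (suc (s n + s n))))

module LacunarySequence {s : ℕ → ℕ} (lacunary : Lacunary s) where

  s-<-suc : ∀ n → s n < s (suc n)
  s-<-suc n = ≤-<-trans (m≤m+n (s n) (s n)) (lacunary n)

  s-mono-< : ∀ {i j} → i < j → s i < s j
  s-mono-< {i} {suc j} (s≤s i≤j) with m≤n⇒m<n∨m≡n i≤j
  ... | inj₁ i<j = <-trans (s-mono-< i<j) (s-<-suc j)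
  ... | inj₂ refl = s-<-suc j

  s-mono-≤ : ∀ {i j} → i ≤ j → s i ≤ s j
  s-mono-≤ i≤j with m≤n⇒m<n∨m≡n i≤j
  ... | inj₁ i<j = <⇒≤ (s-mono-< i<j)
  ... | inj₂ refl = ≤-refl

  s-cancel-< : ∀ {i j} → s i < s j → i < j
  s-cancel-< si<sj = ≰⇒> (λ j≤i → <⇒≱ si<sj (s-mono-≤ j≤i))

  s-injective : ∀ {i j} → s i ≡ s j → i ≡ j
  s-injective e = ≤-antisym (≮⇒≥ (λ j<i → <⇒≢ (s-mono-< j<i) (sym e)))
                            (≮⇒≥ (λ i<j → <⇒≢ (s-mono-< i<j) e))

  n≤s[n] : ∀ n → n ≤ s n
  n≤s[n] zero = z≤n
  n≤s[n] (suc n) = ≤-<-trans (n≤s[n] n) (s-<-suc n)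

  sum-<-next : ∀ {i j m} → i ≤ m → j ≤ m → s i + s j < s (suc m)
  sum-<-next {m = m} i≤m j≤m = ≤-<-trans (+-mono-≤ (s-mono-≤ i≤m) (s-mono-≤ j≤m)) (lacunary m)

  top-dominates : ∀ {a b c d} → a < b → c < b → s a + s c ≢ s b + s d
  top-dominates {b = suc m} (s≤s a≤m) (s≤s c≤m) =
    <⇒≢ (<-≤-trans (sum-<-next a≤m c≤m) (m≤m+n (s (suc m)) _))

  equal-gaps⇒equal-tops : ∀ {i j i' j'} → i < j → i' < j' →
    s j + s i' ≡ s j' + s i → j ≡ j'
  equal-gaps⇒equal-tops {j = j} {j' = j'} i<j i'<j' e with <-cmp j j'
  ... | tri< j<j' _ _ = ⊥-elim (top-dominates j<j' i'<j' e)
  ... | tri≈ _ j≡j' _ = j≡j'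
  ... | tri> _ _ j'<j = ⊥-elim (top-dominates j'<j i<j (sym e))

  ordered-pair-shift≡0 : ∀ {i j i' j' k} → i < j →
    s i + k ≡ s i' → s j + k ≡ s j' → k ≡ 0
  ordered-pair-shift≡0 {i} {j} {i'} {j'} {k} i<j e₁ e₂ =
    +-cancelˡ-≡ (s j) k 0 (trans e₂ (trans (cong s (sym j≡j')) (sym (+-identityʳ (s j)))))
    where
    i'<j' : i' < j'
    i'<j' = s-cancel-< (subst₂ _<_ e₁ e₂ (+-monoˡ-< k (s-mono-< i<j)))

    equal-gaps : s j + s i' ≡ s j' + s i
    equal-gaps = begin
      s j + s i'       ≡⟨ cong (s j +_) (trans (sym e₁) (+-comm (s i) k)) ⟩
      s j + (k + s i)  ≡⟨ +-assoc (s j) k (s i) ⟨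
      s j + k + s i    ≡⟨ cong (_+ s i) e₂ ⟩
      s j' + s i       ∎
      where open ≡-Reasoning

    j≡j' : j ≡ j'
    j≡j' = equal-gaps⇒equal-tops i<j i'<j' equal-gaps

  pair-shift≡0 : ∀ {i j i' j' k} → i ≢ j →
    s i + k ≡ s i' → s j + k ≡ s j' → k ≡ 0
  pair-shift≡0 {i} {j} i≢j e₁ e₂ with <-cmp i j
  ... | tri< i<j _ _ = ordered-pair-shift≡0 i<j e₁ e₂
  ... | tri≈ _ i≡j _ = ⊥-elim (i≢j i≡j)
  ... | tri> _ _ j<i = ordered-pair-shift≡0 j<i e₂ e₁

  pair-shift-rigid : ∀ {i j i' j' k} → i ≢ j →
    s i + k ≡ s i' → s j + k ≡ s j' → i ≡ i'
  pair-shift-rigid {i} i≢j e₁ e₂ with refl ← pair-shift≡0 i≢j e₁ e₂ =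
    s-injective (trans (sym (+-identityʳ (s i))) e₁)

module _ {s : ℕ → ℕ} (lacunary : Lacunary s) where
  open LacunarySequence {s} lacunary

  image-infinite : ∀ {I} → Infinite I → Infinite (image s I)
  image-infinite inf n with inf n
  ... | m , n≤m , Im = s m , ≤-trans n≤m (n≤s[n] m) , m , Im , refl

  image-disjoint : ∀ {I J} → Disjoint I J → Disjoint (image s I) (image s J)
  image-disjoint I∩J=∅ _ (i , Ii , refl) (j , Jj , e) =
    I∩J=∅ i Ii (subst _ (s-injective e) Jj)

  image-pair-unembeddable : ∀ {I J} → Disjoint I J →
    (C : SubsetN) → C ⊆ image s I → HasSize2 C → ¬ (C ≤fe image s J)
  image-pair-unembeddable {J = J} I∩J=∅ C C⊆sI (a , b , a≢b , C=ab) C≤sJ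
    with a∈C ← proj₂ (C=ab a) (inj₁ refl) | b∈C ← proj₂ (C=ab b) (inj₂ refl)
    with C≤sJ (a ∷ b ∷ []) (a∈C ∷ b∈C ∷ []) | C⊆sI a a∈C | C⊆sI b b∈C
  ... | k , (i' , Ji' , e₁) ∷ (_ , _ , e₂) ∷ [] | i , Ii , refl | _ , _ , refl =
    I∩J=∅ i Ii (subst J (sym (pair-shift-rigid (a≢b ∘ cong s) (sym e₁) (sym e₂))) Ji')

proposition8 : (X : SubsetN) → Infinite X →
    Σ SubsetN (λ A → Σ SubsetN (λ B →
    A ⊆ X × B ⊆ X × Infinite A × Infinite B × Disjoint A B ×
    ((C : SubsetN) → C ⊆ A → HasSize2 C → ¬ (C ≤fe B)) ×
    ((D : SubsetN) → D ⊆ B → HasSize2 D → ¬ (D ≤fe A))))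
proposition8 X inf with s , lacunary , s∈X ← lacunary-sequence-in X inf =
  image s Even , image s Odd ,
  image⊆X , image⊆X ,
  image-infinite lacunary even-infinite , image-infinite lacunary odd-infinite ,
  image-disjoint lacunary even-odd-disjoint ,
  image-pair-unembeddable lacunary even-odd-disjoint ,
  image-pair-unembeddable lacunary (λ n odd even → even-odd-disjoint n even odd)
  where
  image⊆X : ∀ {I} → image s I ⊆ X
  image⊆X _ (n , _ , refl) = s∈X n
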